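{- Let $G$ be a trigraph with maximum red degree at most $2$ such that each red edge of $G$ is incident to a vertex of degree at most $2$. If $G'$ is the graph obtained from $G$ by making all edges black, then $\mathrm{tww}(G) \le \mathrm{tww}(G') + 4$.
   Context: A trigraph is a graph whose edge set is partitioned into black and red edges; the degree of a vertex counts edges of both colors, and its red degree counts only red edges. Contracting two distinct vertices $u,v$ of a trigraph produces a new trigraph by removing $u,v$ and adding a new vertex $w$, with a black edge $wx$ for each $x$ such that $xu$ and $xv$ are both black edges, and a red edge $wy$ for each $y$ such that $yu$ or $yv$ is red, or $y$ has a black edge to exactly one of $u,v$. A contraction sequence of a trigraph is a sequence of trigraphs starting at it, each obtained from the previous by one contraction, ending with a single-vertex trigraph. Its width is the maximum red degree of any vertex in any trigraph of the sequence. The twin-width $\mathrm{tww}(\cdot)$ is the minimum width of a contraction sequence. -}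

module Defs where

open import Data.Nat using (ℕ; zero; suc; _≤_)
open import Data.Bool using (Bool; true; false; if_then_else_; _∧_; not)
open import Data.Fin using (Fin; _≟_)
open import Data.Fin.Subset using (Subset; _∈_; _∉_; ∣_∣; _─_; ⁅_⁆)
open import Data.Fin.Subset.Properties using (_∈?_)
open import Data.List using (List; map; allFin)
open import Data.Nat.ListAction using (sum)
open import Data.Product using (_×_; _,_)
open import Relation.Nullary using (¬_; does)
open import Relation.Binary.PropositionalEquality using (_≡_)

data Col : Set where
  none black red : Col

isRed : Col → Bool
isRed red = true
isRed _   = false

isEdge : Col → Bool
isEdge none = false
isEdge _    = true

-- A trigraph whose vertex set is a subset S of the universe Fin N,
-- with edge colours given by a function on pairs of universe elements
-- (only pairs inside S matter).
record Trigraph (N : ℕ) : Set where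
  constructor mkTri
  field
    verts : Subset N
    col   : Fin N → Fin N → Col
open Trigraph public

WellFormed : ∀ {N} → Trigraph N → Set
WellFormed G = (∀ x y → col G x y ≡ col G y x) × (∀ x → col G x x ≡ none)

countF : ∀ {N} → (Fin N → Bool) → ℕ
countF {N} p = sum (map (λ i → if p i then 1 else 0) (allFin N))

nbr? : ∀ {N} → Trigraph N → Fin N → Fin N → Bool
nbr? G x y = does (y ∈? verts G) ∧ not (does (x ≟ y)) ∧ isEdge (col G x y)

redNbr? : ∀ {N} → Trigraph N → Fin N → Fin N → Bool
redNbr? G x y = does (y ∈? verts G) ∧ not (does (x ≟ y)) ∧ isRed (col G x y)

degree : ∀ {N} → Trigraph N → Fin N → ℕ
degree G x = countF (nbr? G x)

redDegree : ∀ {N} → Trigraph N → Fin N → ℕ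
redDegree G x = countF (redNbr? G x)

mergeCol : Col → Col → Col
mergeCol black black = black
mergeCol none  none  = none
mergeCol _     _     = red

-- Contract u and v: the new vertex w reuses the label u; v is removed.
contract : ∀ {N} → Trigraph N → Fin N → Fin N → Trigraph N
contract {N} G u v = mkTri (verts G ─ ⁅ v ⁆) c
  where
  c : Fin N → Fin N → Col
  c x y with does (x ≟ u) | does (y ≟ u)
  ... | true  | true  = none
  ... | true  | false = mergeCol (col G u y) (col G v y)
  ... | false | true  = mergeCol (col G u x) (col G v x)
  ... | false | false = col G x y

MaxRedDeg≤ : ∀ {N} → Trigraph N → ℕ → Set
MaxRedDeg≤ G d = ∀ x → x ∈ verts G → redDegree G x ≤ d

data HasSeq {N : ℕ} (d : ℕ) : Trigraph N → Set where
  done : ∀ {G} → ∣ verts G ∣ ≡ 1 → MaxRedDeg≤ G d → HasSeq d G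
  step : ∀ {G} (u v : Fin N) → u ∈ verts G → v ∈ verts G → ¬ (u ≡ v) →
         MaxRedDeg≤ G d → HasSeq d (contract G u v) → HasSeq d G

TwwAtMost : ∀ {N} → Trigraph N → ℕ → Set
TwwAtMost G d = HasSeq d G

blacken : Col → Col
blacken none = none
blacken _    = black

allBlack : ∀ {N} → Trigraph N → Trigraph N
allBlack G = mkTri (verts G) (λ x y → blacken (col G x y))

{-# OPTIONS --safe #-}

-- Contract G along the contraction sequence of G' = allBlack G. Each vertex x of the current
-- trigraph H stands for a part of V(G), and the corresponding trigraph H' of the sequence of G'
-- differs from H only in that some red edges xy of H are black in H'; for such y the parts of x
-- and y are fully adjacent in G and joined by a red edge of G. If the part of x has at most two
-- vertices, at most 2 · 2 red edges of G leave it, so there are at most 4 such y. Otherwise take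
-- one such y and a red edge ab of G from the part of x to the part of y: b is adjacent to the
-- whole part of x, so deg b ≥ 3 and by hypothesis deg a ≤ 2, while a is adjacent to every such y.
-- Either way the red degree of x exceeds that in H' by at most 4.

module Submission where

open import Defs
open import Algebra.Properties.CommutativeSemigroup using (interchange)
open import Data.Bool using (Bool; true; false; T; if_then_else_; _∧_; not)
open import Data.Bool.Properties using (T-∧)
open import Data.Empty using (⊥-elim)
open import Data.Fin using (Fin; zero; suc; _≟_)
open import Data.Fin.Properties using (0≢1+n; suc-injective; any?)
open import Data.Fin.Subset using (Subset; _∈_; _∉_; _─_; ⁅_⁆; ∣_∣)
open import Data.Fin.Subset.Properties using (_∈?_; p─q⊆p; x∉⁅y⁆⇒x≢y)
open import Data.List.Properties using (map-tabulate)
open import Data.Nat using (ℕ; zero; suc; _≤_; _+_; _*_; z≤n; s≤s)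
open import Data.Nat.ListAction using (sum)
open import Data.Nat.Properties
  using (≤-trans; ≤-reflexive; +-mono-≤; +-monoˡ-≤; +-monoʳ-≤; *-monoˡ-≤; *-distribʳ-+;
         m≤m+n; _≤?_; +-commutativeSemigroup; module ≤-Reasoning)
open import Data.Product using (_×_; _,_; proj₁; ∃-syntax; ∃₂)
open import Data.Sum as Sum using (_⊎_; inj₁; inj₂; [_,_]′)
open import Data.Unit using (tt)
open import Data.Vec using (_∷_; there)
open import Function using (_∘_; id; case_of_; Equivalence)
open import Level using (0ℓ)
open import Relation.Binary.PropositionalEquality using (_≡_; _≢_; refl; sym; trans; cong; subst)
open import Relation.Nullary using (¬_; does; yes; no)
open import Relation.Nullary.Decidable
  using (dec-true; dec-false; isYes; toWitness; fromWitness; T?; _×-dec_)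
open import Relation.Unary using (Pred; _∪_; _⊆_; _≐_)

private variable
  n : ℕ
  a b u v x y z : Fin n
  c c' d d' : Col

T-∧-not : ∀ {s t} → T (s ∧ not t) → T s × ¬ T t
T-∧-not {true}  {false} _ = tt , λ ()
T-∧-not {true}  {true}  ()
T-∧-not {false}         ()

countF-suc : (p : Fin (suc n) → Bool) → countF p ≡ (if p zero then 1 else 0) + countF (p ∘ suc)
countF-suc p = cong (λ xs → (if p zero then 1 else 0) + sum xs)
  (trans (map-tabulate suc f) (sym (map-tabulate id (f ∘ suc))))
  where f = λ i → if p i then 1 else 0

countF-none : {p : Fin n → Bool} → (∀ i → ¬ T (p i)) → countF p ≡ 0
countF-none {zero} _ = refl
countF-none {suc n} {p} ¬p rewrite countF-suc p with p zero | ¬p zero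
... | false | _   = countF-none (¬p ∘ suc)
... | true  | ¬tt = ⊥-elim (¬tt tt)

countF-mono : {p q : Fin n → Bool} → (∀ i → T (p i) → T (q i)) → countF p ≤ countF q
countF-mono {zero} _ = z≤n
countF-mono {suc n} {p} {q} p⊆q rewrite countF-suc p | countF-suc q =
  +-mono-≤ (indicator-mono (p zero) (q zero) (p⊆q zero)) (countF-mono (p⊆q ∘ suc))
  where
  indicator-mono : ∀ a b → (T a → T b) → (if a then 1 else 0) ≤ (if b then 1 else 0)
  indicator-mono false _     _ = z≤n
  indicator-mono true  true  _ = s≤s z≤n
  indicator-mono true  false f = ⊥-elim (f tt)

countF-≤1 : {p : Fin n → Bool} → (∀ i j → T (p i) → T (p j) → i ≡ j) → countF p ≤ 1
countF-≤1 {zero} _ = z≤n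
countF-≤1 {suc n} {p} unique rewrite countF-suc p with p zero in p₀
... | true  =
  s≤s (≤-reflexive (countF-none λ i pi → 0≢1+n (unique zero (suc i) (subst T (sym p₀) tt) pi)))
... | false = countF-≤1 λ i j pi pj → suc-injective (unique (suc i) (suc j) pi pj)

countF-split : (p q : Fin n → Bool) → countF p ≤ countF q + countF (λ i → p i ∧ not (q i))
countF-split {zero} _ _ = z≤n
countF-split {suc n} p q rewrite countF-suc p | countF-suc q | countF-suc (λ i → p i ∧ not (q i)) =
  ≤-trans (+-mono-≤ (indicator-split (p zero) (q zero)) (countF-split (p ∘ suc) (q ∘ suc)))
          (≤-reflexive (interchange +-commutativeSemigroup
            (if q zero then 1 else 0) _ (countF (q ∘ suc)) _))
  where
  indicator-split : ∀ a b → (if a then 1 else 0) ≤ (if b then 1 else 0) + (if a ∧ not b then 1 else 0)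
  indicator-split false _     = z≤n
  indicator-split true  true  = s≤s z≤n
  indicator-split true  false = s≤s z≤n

countF-cover : ∀ {m} (k : ℕ) (P : Fin m → Bool) (R : Fin m → Fin n → Bool) {q : Fin n → Bool} →
               (∀ a → T (P a) → countF (R a) ≤ k) →
               (∀ y → T (q y) → ∃[ a ] T (P a) × T (R a y)) →
               countF q ≤ countF P * k
countF-cover {m = zero} k P R bound covered =
  ≤-reflexive (countF-none λ y qy → case covered y qy of λ ())
countF-cover {m = suc m} k P R {q} bound covered = begin
  countF q                                              ≤⟨ countF-split q R₀ ⟩
  countF R₀ + countF (λ y → q y ∧ not (R₀ y))           ≤⟨ +-mono-≤ R₀-bound rest-bound ⟩
  (if P zero then 1 else 0) * k + countF (P ∘ suc) * k  ≡⟨ sym (*-distribʳ-+ k (if P zero then 1 else 0) _) ⟩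
  ((if P zero then 1 else 0) + countF (P ∘ suc)) * k    ≡⟨ cong (_* k) (sym (countF-suc P)) ⟩
  countF P * k                                          ∎
  where
  open ≤-Reasoning
  R₀ : Fin _ → Bool
  R₀ y = P zero ∧ R zero y

  R₀-bound : countF R₀ ≤ (if P zero then 1 else 0) * k
  R₀-bound with P zero | bound zero
  ... | true  | bound₀ = ≤-trans (bound₀ tt) (m≤m+n k 0)
  ... | false | _      = ≤-reflexive (countF-none {p = λ y → false ∧ R zero y} λ _ ())

  rest-bound : countF (λ y → q y ∧ not (R₀ y)) ≤ countF (P ∘ suc) * k
  rest-bound = countF-cover k (P ∘ suc) (R ∘ suc) (bound ∘ suc) covered-by-rest
    where
    covered-by-rest : ∀ y → T (q y ∧ not (R₀ y)) → ∃[ a ] T (P (suc a)) × T (R (suc a) y)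
    covered-by-rest y t with T-∧-not t
    ... | qy , ¬R₀y with covered y qy
    ... | zero  , Pa , Ray = ⊥-elim (¬R₀y (Equivalence.from T-∧ (Pa , Ray)))
    ... | suc a , Pa , Ray = a , Pa , Ray

data _↝_ : Col → Col → Set where
  same      : ∀ {c} → c ↝ c
  red↝black : red ↝ black

↝-blacken : ∀ c → c ↝ blacken c
↝-blacken none  = same
↝-blacken black = same
↝-blacken red   = red↝black

blacken≡black⇒isEdge : ∀ c → blacken c ≡ black → T (isEdge c)
blacken≡black⇒isEdge black _ = tt
blacken≡black⇒isEdge red   _ = tt

mergeCol-↝ : c ↝ c' → d ↝ d' → mergeCol c d ↝ mergeCol c' d'
mergeCol-↝             same      same      = same
mergeCol-↝             red↝black red↝black = red↝black
mergeCol-↝ {d = none}  red↝black same      = same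
mergeCol-↝ {d = black} red↝black same      = red↝black
mergeCol-↝ {d = red}   red↝black same      = same
mergeCol-↝ {c = none}  same      red↝black = same
mergeCol-↝ {c = black} same      red↝black = red↝black
mergeCol-↝ {c = red}   same      red↝black = same

mergeCol-black⁻ : ∀ c d → mergeCol c d ≡ black → c ≡ black × d ≡ black
mergeCol-black⁻ black black refl = refl , refl
mergeCol-black⁻ black none  ()
mergeCol-black⁻ black red   ()
mergeCol-black⁻ none  none  ()
mergeCol-black⁻ none  black ()
mergeCol-black⁻ none  red   ()
mergeCol-black⁻ red   _     ()

mergeCol-red⁻ : c ↝ black → d ↝ black → mergeCol c d ≡ red → c ≡ red ⊎ d ≡ red
mergeCol-red⁻ red↝black _         _  = inj₁ refl
mergeCol-red⁻ same      red↝black _  = inj₂ refl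
mergeCol-red⁻ same      same      ()

red↝-non-red : red ↝ c' → c' ≢ red → c' ≡ black
red↝-non-red same      c'≢red = ⊥-elim (c'≢red refl)
red↝-non-red red↝black _      = refl

redNbr?-elim : (H : Trigraph n) {x y : Fin n} → T (redNbr? H x y) →
               y ∈ verts H × x ≢ y × col H x y ≡ red
redNbr?-elim H {x} {y} t with y ∈? verts H | x ≟ y | col H x y
... | yes y∈H | no x≢y | red = y∈H , x≢y , refl

redNbr?-intro : (H : Trigraph n) {x y : Fin n} → y ∈ verts H → x ≢ y → col H x y ≡ red →
                T (redNbr? H x y)
redNbr?-intro H {x} {y} y∈H x≢y xy-red
  rewrite dec-true (y ∈? verts H) y∈H | dec-false (x ≟ y) x≢y | xy-red = tt

nbr?-intro : (H : Trigraph n) {x y : Fin n} → y ∈ verts H → x ≢ y → T (isEdge (col H x y)) →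
             T (nbr? H x y)
nbr?-intro H {x} {y} y∈H x≢y e rewrite dec-true (y ∈? verts H) y∈H | dec-false (x ≟ y) x≢y = e

x∈p─q⇒x∉q : ∀ {x : Fin n} (p q : Subset n) → x ∈ p ─ q → x ∉ q
x∈p─q⇒x∉q (_ ∷ p) (_ ∷ q) (there x∈p─q) (there x∈q) = x∈p─q⇒x∉q p q x∈p─q x∈q

x∈p-y⁻ : (p : Subset n) → x ∈ p ─ ⁅ y ⁆ → x ∈ p × x ≢ y
x∈p-y⁻ {y = y} p x∈p-y =
  p─q⊆p p ⁅ y ⁆ x∈p-y , x∉⁅y⁆⇒x≢y (x∈p─q⇒x∉q p ⁅ y ⁆ x∈p-y)

redirect : Fin n → Fin n → Fin n → Fin n
redirect u v z = if does (z ≟ v) then u else z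

redirect-≢ : z ≢ v → redirect u v z ≡ z
redirect-≢ {z = z} {v = v} z≢v rewrite dec-false (z ≟ v) z≢v = refl

redirect≡⁻ : x ≢ u → redirect u v z ≡ x → z ≡ x
redirect≡⁻ {v = v} {z = z} x≢u e with z ≟ v
... | yes _ = ⊥-elim (x≢u (sym e))
... | no  _ = e

redirect≡u⁻ : redirect u v z ≡ u → z ≡ u ⊎ z ≡ v
redirect≡u⁻ {v = v} {z = z} e with z ≟ v
... | yes z≡v = inj₂ z≡v
... | no  _   = inj₁ e

redirect≡u⁺ : z ≡ u ⊎ z ≡ v → redirect u v z ≡ u
redirect≡u⁺ {z = z} {v = v} z∈uv with z ≟ v
... | yes _   = refl
... | no  z≢v = [ id , ⊥-elim ∘ z≢v ]′ z∈uv

module _ (G : Trigraph n) where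

  Part : (Fin n → Fin n) → Fin n → Pred (Fin n) 0ℓ
  Part rep x a = a ∈ verts G × rep a ≡ x

  Part-disjoint : (rep : Fin n → Fin n) → x ≢ y → Part rep x a → Part rep y b → a ≢ b
  Part-disjoint _ x≢y (_ , rep-a) (_ , rep-b) refl = x≢y (trans (sym rep-a) rep-b)

  part-redirect-u : (rep : Fin n → Fin n) → Part (redirect u v ∘ rep) u ≐ Part rep u ∪ Part rep v
  part-redirect-u rep =
      (λ (a∈G , e) → Sum.map (a∈G ,_) (a∈G ,_) (redirect≡u⁻ e))
    , [ (λ (a∈G , e) → a∈G , redirect≡u⁺ (inj₁ e))
      , (λ (a∈G , e) → a∈G , redirect≡u⁺ (inj₂ e))
      ]′

  part-redirect-≢ : (rep : Fin n → Fin n) → x ≢ u → x ≢ v →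
                    Part (redirect u v ∘ rep) x ≐ Part rep x
  part-redirect-≢ rep x≢u x≢v =
      (λ (a∈G , e) → a∈G , redirect≡⁻ x≢u e)
    , (λ (a∈G , e) → a∈G , trans (redirect-≢ (x≢v ∘ trans (sym e))) e)

  private variable
    X X' Y Y' : Pred (Fin n) 0ℓ
    H H' : Trigraph n
    rep : Fin n → Fin n

  FullyAdjacent : Pred (Fin n) 0ℓ → Pred (Fin n) 0ℓ → Set
  FullyAdjacent X Y = ∀ {a b} → X a → Y b → T (isEdge (col G a b))

  RedEdgeBetween : Pred (Fin n) 0ℓ → Pred (Fin n) 0ℓ → Set
  RedEdgeBetween X Y = ∃₂ λ a b → X a × Y b × col G a b ≡ red

  RedEdgeBetween-mono : X ⊆ X' → Y ⊆ Y' → RedEdgeBetween X Y → RedEdgeBetween X' Y'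
  RedEdgeBetween-mono X⊆X' Y⊆Y' (a , b , Xa , Yb , ab-red) = a , b , X⊆X' Xa , Y⊆Y' Yb , ab-red

  -- c and c' are the colours that the quotients of G and of allBlack G give to the parts X, Y.
  record Faithful (c c' : Col) (X Y : Pred (Fin n) 0ℓ) : Set where
    field
      recolour : c ↝ c'
      complete : c' ≡ black → FullyAdjacent X Y
      red-edge : c' ≡ black → c ≡ red → RedEdgeBetween X Y
  open Faithful

  Faithful-resp : X ≐ X' → Y ≐ Y' → Faithful c c' X' Y' → Faithful c c' X Y
  Faithful-resp (X⊆X' , X'⊆X) (Y⊆Y' , Y'⊆Y) F = record
    { recolour = recolour F
    ; complete = λ bl Xa Yb → complete F bl (X⊆X' Xa) (Y⊆Y' Yb)
    ; red-edge = λ bl rd → RedEdgeBetween-mono X'⊆X Y'⊆Y (red-edge F bl rd)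
    }

  Faithful-merge : Faithful c c' X Y → Faithful d d' X' Y →
                   Faithful (mergeCol c d) (mergeCol c' d') (X ∪ X') Y
  Faithful-merge {c' = c'} {d' = d'} F F' = record
    { recolour = mergeCol-↝ (recolour F) (recolour F')
    ; complete = λ bl → let (c'-black , d'-black) = mergeCol-black⁻ c' d' bl in
        λ { (inj₁ Xa) Yb → complete F c'-black Xa Yb ; (inj₂ X'a) Yb → complete F' d'-black X'a Yb }
    ; red-edge = λ bl rd → let (c'-black , d'-black) = mergeCol-black⁻ c' d' bl in
        [ RedEdgeBetween-mono inj₁ id ∘ red-edge F c'-black
        , RedEdgeBetween-mono inj₂ id ∘ red-edge F' d'-black
        ]′ (mergeCol-red⁻ (subst (_ ↝_) c'-black (recolour F)) (subst (_ ↝_) d'-black (recolour F')) rd)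
    }

  -- H and H' arise from G and allBlack G by the same contractions, and rep sends each vertex
  -- of G to the vertex it has been contracted into.
  record Lockstep (H H' : Trigraph n) (rep : Fin n → Fin n) : Set where
    field
      same-verts : verts H ≡ verts H'
      own-part   : x ∈ verts H → Part rep x x
      faithful   : x ∈ verts H → y ∈ verts H → x ≢ y →
                   Faithful (col H x y) (col H' x y) (Part rep x) (Part rep y)
  open Lockstep

  lockstep-start : Lockstep G (allBlack G) id
  lockstep-start = record
    { same-verts = refl
    ; own-part   = λ x∈G → x∈G , refl
    ; faithful   = λ {x} {y} x∈G y∈G _ → record
      { recolour = ↝-blacken (col G x y)
      ; complete = λ { bl (_ , refl) (_ , refl) → blacken≡black⇒isEdge (col G x y) bl }
      ; red-edge = λ _ xy-red → x , y , (x∈G , refl) , (y∈G , refl) , xy-red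
      }
    }

  module _ (symG : ∀ a b → col G a b ≡ col G b a) where

    Faithful-swap : Faithful c c' X Y → Faithful c c' Y X
    Faithful-swap F = record
      { recolour = recolour F
      ; complete = λ bl Ya Xb → subst (T ∘ isEdge) (symG _ _) (complete F bl Xb Ya)
      ; red-edge = λ bl rd → let (a , b , Xa , Yb , ab-red) = red-edge F bl rd in
                             b , a , Yb , Xa , trans (symG b a) ab-red
      }

    lockstep-contract : Lockstep H H' rep → u ∈ verts H → v ∈ verts H →
                        Lockstep (contract H u v) (contract H' u v) (redirect u v ∘ rep)
    lockstep-contract {H = H} {H'} {rep} {u} {v} L u∈H v∈H = record
      { same-verts = cong (_─ ⁅ v ⁆) (same-verts L)
      ; own-part   = own-part′
      ; faithful   = faithful′
      }
      where
      own-part′ : x ∈ verts (contract H u v) → Part (redirect u v ∘ rep) x x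
      own-part′ x∈K with x∈p-y⁻ (verts H) x∈K
      ... | x∈H , x≢v with own-part L x∈H
      ...   | x∈G , rep-x = x∈G , trans (cong (redirect u v) rep-x) (redirect-≢ x≢v)

      faithful′ : x ∈ verts (contract H u v) → y ∈ verts (contract H u v) → x ≢ y →
                  Faithful (col (contract H u v) x y) (col (contract H' u v) x y)
                           (Part (redirect u v ∘ rep) x) (Part (redirect u v ∘ rep) y)
      -- Matching on x ≟ u and y ≟ u also evaluates the colours in the contracted trigraphs.
      faithful′ {x} {y} x∈K y∈K x≢y
        with x∈p-y⁻ (verts H) x∈K | x∈p-y⁻ (verts H) y∈K | x ≟ u | y ≟ u
      ... | _ | _ | yes refl | yes refl = ⊥-elim (x≢y refl)
      ... | _ | y∈H , y≢v | yes refl | no y≢u =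
        Faithful-resp (part-redirect-u rep) (part-redirect-≢ rep y≢u y≢v)
          (Faithful-merge (faithful L u∈H y∈H (y≢u ∘ sym)) (faithful L v∈H y∈H (y≢v ∘ sym)))
      ... | x∈H , x≢v | _ | no x≢u | yes refl =
        Faithful-resp (part-redirect-≢ rep x≢u x≢v) (part-redirect-u rep)
          (Faithful-swap
            (Faithful-merge (faithful L u∈H x∈H (x≢u ∘ sym)) (faithful L v∈H x∈H (x≢v ∘ sym))))
      ... | x∈H , x≢v | y∈H , y≢v | no x≢u | no y≢u =
        Faithful-resp (part-redirect-≢ rep x≢u x≢v) (part-redirect-≢ rep y≢u y≢v)
          (faithful L x∈H y∈H x≢y)

module _ {G : Trigraph n} (symG : ∀ a b → col G a b ≡ col G b a) (G-red≤2 : MaxRedDeg≤ G 2)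
         (red-edge-low : ∀ a b → a ∈ verts G → b ∈ verts G → col G a b ≡ red →
                         degree G a ≤ 2 ⊎ degree G b ≤ 2) where

  private variable
    H H' : Trigraph n
    rep : Fin n → Fin n
    t : ℕ

  module _ (L : Lockstep G H H' rep) (x∈H : x ∈ verts H) where
    open Lockstep L

    lostRed? : Fin n → Bool
    lostRed? y = redNbr? H x y ∧ not (redNbr? H' x y)

    lostRed⇒ : ∀ y → T (lostRed? y) → y ∈ verts H × x ≢ y ×
               FullyAdjacent G (Part G rep x) (Part G rep y) × RedEdgeBetween G (Part G rep x) (Part G rep y)
    lostRed⇒ y lost with T-∧-not lost
    ... | red-in-H , ¬red-in-H' with redNbr?-elim H red-in-H
    ...   | y∈H , x≢y , xy-red =
      y∈H , x≢y , Faithful.complete F xy-black , Faithful.red-edge F xy-black xy-red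
      where
      F = faithful x∈H y∈H x≢y
      xy-black : col H' x y ≡ black
      xy-black = red↝-non-red (subst (_↝ col H' x y) xy-red (Faithful.recolour F))
                   (¬red-in-H' ∘ redNbr?-intro H' (subst (y ∈_) same-verts y∈H) x≢y)

    part? : Fin n → Bool
    part? a = isYes (a ∈? verts G ×-dec rep a ≟ x)

    redNbrOfPart? : Fin n → Bool
    redNbrOfPart? b = isYes (any? λ a → (a ∈? verts G ×-dec rep a ≟ x) ×-dec T? (redNbr? G a b))

    lostRed-small-part : countF part? ≤ 2 → countF lostRed? ≤ 4
    lostRed-small-part small = begin
      countF lostRed?           ≤⟨ countF-cover 1 redNbrOfPart? (λ b y → isYes (rep b ≟ y))
                                                  rep-unique lost⇒image ⟩
      countF redNbrOfPart? * 1  ≤⟨ *-monoˡ-≤ 1 (countF-cover 2 part? (redNbr? G) part-red≤2 redNbr⇒part) ⟩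
      countF part? * 2 * 1      ≤⟨ *-monoˡ-≤ 1 (*-monoˡ-≤ 2 small) ⟩
      4                         ∎
      where
      open ≤-Reasoning
      rep-unique : ∀ b → T (redNbrOfPart? b) → countF (λ y → isYes (rep b ≟ y)) ≤ 1
      rep-unique b _ = countF-≤1 {p = λ y → isYes (rep b ≟ y)}
                         λ y y' rep-y rep-y' → trans (sym (toWitness rep-y)) (toWitness rep-y')
      lost⇒image : ∀ y → T (lostRed? y) → ∃[ b ] T (redNbrOfPart? b) × T (isYes (rep b ≟ y))
      lost⇒image y lost with lostRed⇒ y lost
      ... | _ , x≢y , _ , (a , b , Xa , Yb@(b∈G , rep-b) , ab-red) =
        b , fromWitness (a , Xa , redNbr?-intro G b∈G (Part-disjoint G rep x≢y Xa Yb) ab-red)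
          , fromWitness rep-b
      part-red≤2 : ∀ a → T (part? a) → redDegree G a ≤ 2
      part-red≤2 a Xa = G-red≤2 a (proj₁ (toWitness Xa))
      redNbr⇒part : ∀ b → T (redNbrOfPart? b) → ∃[ a ] T (part? a) × T (redNbr? G a b)
      redNbr⇒part b t with toWitness t
      ... | a , Xa , ab-red = a , fromWitness Xa , ab-red

    lostRed-large-part : ¬ countF part? ≤ 2 → countF lostRed? ≤ 2
    lostRed-large-part large with any? (λ y → T? (lostRed? y))
    ... | no nothing-lost = ≤-trans (≤-reflexive (countF-none λ y lost → nothing-lost (y , lost))) z≤n
    ... | yes (y₀ , lost₀) with lostRed⇒ y₀ lost₀
    ...   | _ , x≢y₀ , adjacent₀ , (a , b , Xa@(a∈G , rep-a) , Yb@(b∈G , rep-b) , ab-red) =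
      ≤-trans (countF-mono lost⇒nbr-a) a-low
      where
      part⊆nbr-b : ∀ a' → T (part? a') → T (nbr? G b a')
      part⊆nbr-b a' t = nbr?-intro G (proj₁ Xa') (Part-disjoint G rep x≢y₀ Xa' Yb ∘ sym)
                          (subst (T ∘ isEdge) (symG a' b) (adjacent₀ Xa' Yb))
        where Xa' = toWitness t
      a-low : degree G a ≤ 2
      a-low = [ id , (λ b-low → ⊥-elim (large (≤-trans (countF-mono part⊆nbr-b) b-low))) ]′
                (red-edge-low a b a∈G b∈G ab-red)
      lost⇒nbr-a : ∀ y → T (lostRed? y) → T (nbr? G a y)
      lost⇒nbr-a y lost with lostRed⇒ y lost
      ... | y∈H , x≢y , adjacent , _ =
        nbr?-intro G (proj₁ Yy) (Part-disjoint G rep x≢y Xa Yy) (adjacent Xa Yy)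
        where Yy = own-part y∈H

    lostRed-≤4 : countF lostRed? ≤ 4
    lostRed-≤4 with countF part? ≤? 2
    ... | yes small = lostRed-small-part small
    ... | no  large = ≤-trans (lostRed-large-part large) (m≤m+n 2 2)

  redDegree-lockstep : Lockstep G H H' rep → x ∈ verts H → redDegree H x ≤ redDegree H' x + 4
  redDegree-lockstep {H = H} {H'} {x = x} L x∈H =
    ≤-trans (countF-split (redNbr? H x) (redNbr? H' x)) (+-monoʳ-≤ (redDegree H' x) (lostRed-≤4 L x∈H))

  maxRedDeg-lockstep : Lockstep G H H' rep → MaxRedDeg≤ H' t → MaxRedDeg≤ H (t + 4)
  maxRedDeg-lockstep L H'-red≤t x x∈H =
    ≤-trans (redDegree-lockstep L x∈H)
            (+-monoˡ-≤ 4 (H'-red≤t x (subst (x ∈_) (Lockstep.same-verts L) x∈H)))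

  simulate : HasSeq t H' → Lockstep G H H' rep → HasSeq (t + 4) H
  simulate (done one H'-red≤t) L =
    done (trans (cong ∣_∣ (Lockstep.same-verts L)) one) (maxRedDeg-lockstep L H'-red≤t)
  simulate (step u v u∈H' v∈H' u≢v H'-red≤t rest) L =
    step u v u∈H v∈H u≢v (maxRedDeg-lockstep L H'-red≤t)
      (simulate rest (lockstep-contract G symG L u∈H v∈H))
    where
    u∈H = subst (u ∈_) (sym (Lockstep.same-verts L)) u∈H'
    v∈H = subst (v ∈_) (sym (Lockstep.same-verts L)) v∈H'

lemma7 : ∀ {N : ℕ} (G : Trigraph N) → WellFormed G →
           MaxRedDeg≤ G 2 →
           (∀ x y → x ∈ verts G → y ∈ verts G → col G x y ≡ red →
              degree G x ≤ 2 ⊎ degree G y ≤ 2) →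
           ∀ (t : ℕ) → TwwAtMost (allBlack G) t → TwwAtMost G (t + 4)
lemma7 G (symG , _) G-red≤2 red-edge-low t seq = simulate symG G-red≤2 red-edge-low seq (lockstep-start G)
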